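{- Let $(p\colon \mathbb{E}\to\mathbb{B}, O, \Omega)$ be a $\mathbf{CLat}_\sqcap$-fibration with truth values indexed by a discrete category $A$, let $F\colon\mathbb{B}\to\mathbb{B}$ with modality $\tau\colon F\circ O\Rightarrow O$, and let $(T,\lambda)$ be an $N$-ary one-step composition operation for $F$-coalgebras. Then a modality $\sigma\colon T\circ\langle O,\dots,O\rangle\Rightarrow O$ lifts $\lambda$ along $p$ if the following two conditions hold: (1) for each $a\in A$, $\sigma_a\circ T(\tau_a,\dots,\tau_a)=\tau_a\circ F\sigma_a\circ\lambda_{(O(a),\dots,O(a))}$ (equivalently, $\lambda$ is a 2-cell $(T,\sigma)\circ(F^N,\tau^N)\Rightarrow(F,\tau)\circ(T,\sigma)$ in the lax coslice 2-category under $A$); (2) for all $P_1,\dots,P_N\in\mathbb{E}$, $$\bigwedge_{a\in A,\ k_i\in\mathbb{E}(P_i,\Omega(a))}\bigl(\tau_a\circ F(\sigma_a\circ T(pk_1,\dots,pk_N))\bigr)^*\Omega(a)\;=\;F^{\Omega}_{\tau}\bigl(T^{\Omega}_{\sigma}(P_1,\dots,P_N)\bigr),$$ i.e. $R^{\Omega}_{p}\circ\mathrm{Sp}^A(F,\tau)\circ\mathrm{Sp}^A(T,\sigma)\circ L^{\Omega^N}_{p^N}=F^{\Omega}_{\tau}\circ T^{\Omega}_{\sigma}$.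
   Context: A $\mathbf{CLat}_\sqcap$-fibration is a posetal fibration $p\colon\mathbb{E}\to\mathbb{B}$ whose fibers $\mathbb{E}_X$ are complete lattices (order $\sqsubseteq$, meet written $\bigwedge$) and whose reindexing maps $f^*$ preserve all meets. A $\mathbf{CLat}_\sqcap$-fibration with truth values is a tuple $(p, O\colon A\to\mathbb{B}, \Omega\colon A\to\mathbb{E})$ with $A$ discrete and $O=p\circ\Omega$. A morphism $f\colon pP\to pQ$ underlies an $\mathbb{E}$-morphism $P\to Q$ iff $P\sqsubseteq f^*Q$. The codensity lifting of $F$ is $F^{\Omega}_{\tau}(P)=\bigwedge_{a\in A,\,k\in\mathbb{E}(P,\Omega(a))}(\tau_a\circ F(pk))^*\Omega(a)$, and the $N$-codensity lifting of $T\colon\mathbb{B}^N\to\mathbb{B}$ is $T^{\Omega}_{\sigma}(P_1,\dots,P_N)=\bigwedge_{a\in A,\,k_i\in\mathbb{E}(P_i,\Omega(a))}(\sigma_a\circ T(pk_1,\dots,pk_N))^*\Omega(a)$. An $N$-ary one-step composition operation is a functor $T\colon\mathbb{B}^N\to\mathbb{B}$ with a natural transformation $\lambda\colon T\circ F^N\Rightarrow F\circ T$. "$\sigma$ lifts $\lambda$ along $p$" means that for all $P_1,\dots,P_N\in\mathbb{E}$, $T^{\Omega}_{\sigma}(F^{\Omega}_{\tau}P_1,\dots,F^{\Omega}_{\tau}P_N)\sqsubseteq\lambda^*\,F^{\Omega}_{\tau}(T^{\Omega}_{\sigma}(P_1,\dots,P_N))$. In condition (2), $\mathrm{Sp}^A(\mathbb{B},O)$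 is the category of pairs $(X,S)$ with $S(a)\subseteq\mathbb{B}(X,O(a))$; $L^{\Omega}_p(P)=(pP,\,a\mapsto\{pk\mid k\in\mathbb{E}(P,\Omega(a))\})$, $R^{\Omega}_p(X,S)=\bigwedge_{a,\,k\in S(a)}k^*\Omega(a)$, $\mathrm{Sp}^A(F,\tau)(X,S)=(FX,\,a\mapsto\{\tau_a\circ Fk\mid k\in S(a)\})$, and analogously for $N$-tuples and $(T,\sigma)$. -}

module Defs where

open import Level using (Level; suc)
open import Data.Nat using (ℕ)
open import Data.Fin using (Fin)
open import Data.Product using (Σ; _×_; _,_; proj₁; proj₂)
open import Relation.Binary.PropositionalEquality using (_≡_)

record Category (ℓ : Level) : Set (suc ℓ) where
  infixr 9 _∘_
  field
    Obj : Set ℓ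
    Hom : Obj → Obj → Set ℓ
    id  : ∀ {X} → Hom X X
    _∘_ : ∀ {X Y Z} → Hom Y Z → Hom X Y → Hom X Z
    identityˡ : ∀ {X Y} (f : Hom X Y) → id ∘ f ≡ f
    identityʳ : ∀ {X Y} (f : Hom X Y) → f ∘ id ≡ f
    assoc : ∀ {W X Y Z} (h : Hom Y Z) (g : Hom X Y) (f : Hom W X) →
            (h ∘ g) ∘ f ≡ h ∘ (g ∘ f)

-- A CLat_⊓-fibration over 𝔹, presented (Grothendieck) by its fibres and reindexing:
-- fibre 𝔼_X is a complete lattice (E X, ⊑, ⋀), reindexing f^* preserves all meets,
-- and is (split) functorial, as for any posetal fibration.
-- The total category 𝔼 has objects (X , P) with P : E X, and an 𝔼-morphism
-- P → Q over f is exactly a proof of P ⊑ f^* Q.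
record CLatFibration {ℓ : Level} (𝔹 : Category ℓ) : Set (suc ℓ) where
  open Category 𝔹
  field
    E   : Obj → Set ℓ
    _⊑_ : ∀ {X} → E X → E X → Set ℓ
    ⊑-refl    : ∀ {X} (P : E X) → P ⊑ P
    ⊑-trans   : ∀ {X} {P Q R : E X} → P ⊑ Q → Q ⊑ R → P ⊑ R
    ⊑-antisym : ∀ {X} {P Q : E X} → P ⊑ Q → Q ⊑ P → P ≡ Q
    ⋀ : ∀ {X} {I : Set ℓ} → (I → E X) → E X
    ⋀-lower    : ∀ {X} {I : Set ℓ} (φ : I → E X) (i : I) → ⋀ φ ⊑ φ i
    ⋀-greatest : ∀ {X} {I : Set ℓ} (φ : I → E X) (P : E X) →
                 (∀ i → P ⊑ φ i) → P ⊑ ⋀ φ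
    _^* : ∀ {X Y} → Hom X Y → E Y → E X
    reindex-id : ∀ {X} (P : E X) → (id ^*) P ≡ P
    reindex-∘  : ∀ {X Y Z} (g : Hom Y Z) (f : Hom X Y) (P : E Z) →
                 ((g ∘ f) ^*) P ≡ (f ^*) ((g ^*) P)
    reindex-⋀  : ∀ {X Y} (f : Hom X Y) {I : Set ℓ} (φ : I → E Y) →
                 (f ^*) (⋀ φ) ≡ ⋀ (λ i → (f ^*) (φ i))

  EHom : ∀ {X Y} → E X → E Y → Set ℓ
  EHom {X} {Y} P Q = Σ (Hom X Y) (λ f → P ⊑ (f ^*) Q)

record Functor {ℓ : Level} (𝔹 : Category ℓ) : Set ℓ where
  open Category 𝔹
  field
    F₀ : Obj → Obj
    F₁ : ∀ {X Y} → Hom X Y → Hom (F₀ X) (F₀ Y)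
    F-id : ∀ {X} → F₁ (id {X}) ≡ id
    F-∘  : ∀ {X Y Z} (g : Hom Y Z) (f : Hom X Y) → F₁ (g ∘ f) ≡ F₁ g ∘ F₁ f

record NFunctor {ℓ : Level} (𝔹 : Category ℓ) (N : ℕ) : Set ℓ where
  open Category 𝔹
  field
    T₀ : (Fin N → Obj) → Obj
    T₁ : ∀ {X Y : Fin N → Obj} → ((i : Fin N) → Hom (X i) (Y i)) → Hom (T₀ X) (T₀ Y)
    T-id : ∀ {X : Fin N → Obj} → T₁ (λ i → id {X i}) ≡ id
    T-∘  : ∀ {X Y Z : Fin N → Obj}
           (g : (i : Fin N) → Hom (Y i) (Z i)) (f : (i : Fin N) → Hom (X i) (Y i)) →
           T₁ (λ i → g i ∘ f i) ≡ T₁ g ∘ T₁ f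

record OneStep {ℓ : Level} {𝔹 : Category ℓ} (F : Functor 𝔹) {N : ℕ} (T : NFunctor 𝔹 N) : Set ℓ where
  open Category 𝔹
  open Functor F
  open NFunctor T
  field
    lam : (X : Fin N → Obj) → Hom (T₀ (λ i → F₀ (X i))) (F₀ (T₀ X))
    lam-natural : ∀ {X Y : Fin N → Obj} (f : (i : Fin N) → Hom (X i) (Y i)) →
                  lam Y ∘ T₁ (λ i → F₁ (f i)) ≡ F₁ (T₁ f) ∘ lam X

-- Codensity liftings and the conditions of the theorem, for a CLat_⊓-fibration
-- with truth values (p, O, Ω) indexed by a discrete category (a type) A.
-- Ω a : E (O a) encodes Ω : A → 𝔼 with p ∘ Ω = O.
module Codensity {ℓ : Level} (𝔹 : Category ℓ) (Fib : CLatFibration 𝔹)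
                 (A : Set ℓ) (O : A → Category.Obj 𝔹)
                 (Ω : (a : A) → CLatFibration.E Fib (O a)) where
  open Category 𝔹
  open CLatFibration Fib

  FLift : (F : Functor 𝔹) (τ : (a : A) → Hom (Functor.F₀ F (O a)) (O a)) →
          ∀ {X} → E X → E (Functor.F₀ F X)
  FLift F τ P =
    ⋀ {I = Σ A (λ a → EHom P (Ω a))}
      (λ { (a , k) → ((τ a ∘ Functor.F₁ F (proj₁ k)) ^*) (Ω a) })

  TLift : {N : ℕ} (T : NFunctor 𝔹 N)
          (σ : (a : A) → Hom (NFunctor.T₀ T (λ _ → O a)) (O a)) →
          {X : Fin N → Obj} → ((i : Fin N) → E (X i)) → E (NFunctor.T₀ T X)
  TLift {N} T σ P =
    ⋀ {I = Σ A (λ a → (i : Fin N) → EHom (P i) (Ω a))}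
      (λ { (a , k) → ((σ a ∘ NFunctor.T₁ T (λ i → proj₁ (k i))) ^*) (Ω a) })

  Lifts : (F : Functor 𝔹) (τ : (a : A) → Hom (Functor.F₀ F (O a)) (O a))
          {N : ℕ} (T : NFunctor 𝔹 N) (λ' : OneStep F T)
          (σ : (a : A) → Hom (NFunctor.T₀ T (λ _ → O a)) (O a)) → Set ℓ
  Lifts F τ {N} T λ' σ =
    ∀ {X : Fin N → Obj} (P : (i : Fin N) → E (X i)) →
      TLift T σ (λ i → FLift F τ (P i))
        ⊑ ((OneStep.lam λ' X) ^*) (FLift F τ (TLift T σ P))

  Condition1 : (F : Functor 𝔹) (τ : (a : A) → Hom (Functor.F₀ F (O a)) (O a))
               {N : ℕ} (T : NFunctor 𝔹 N) (λ' : OneStep F T)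
               (σ : (a : A) → Hom (NFunctor.T₀ T (λ _ → O a)) (O a)) → Set ℓ
  Condition1 F τ T λ' σ =
    ∀ (a : A) →
      σ a ∘ NFunctor.T₁ T (λ _ → τ a)
        ≡ τ a ∘ (Functor.F₁ F (σ a) ∘ OneStep.lam λ' (λ _ → O a))

  Condition2 : (F : Functor 𝔹) (τ : (a : A) → Hom (Functor.F₀ F (O a)) (O a))
               {N : ℕ} (T : NFunctor 𝔹 N)
               (σ : (a : A) → Hom (NFunctor.T₀ T (λ _ → O a)) (O a)) → Set ℓ
  Condition2 F τ {N} T σ =
    ∀ {X : Fin N → Obj} (P : (i : Fin N) → E (X i)) →
      ⋀ {I = Σ A (λ a → (i : Fin N) → EHom (P i) (Ω a))}
        (λ { (a , k) →
          ((τ a ∘ Functor.F₁ F (σ a ∘ NFunctor.T₁ T (λ i → proj₁ (k i)))) ^*) (Ω a) })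
      ≡ FLift F τ (TLift T σ P)

module Submission where

open import Defs
open import Data.Nat using (ℕ)
open import Data.Fin using (Fin)
open import Data.Product using (Σ; _,_; proj₁; proj₂)
open import Relation.Binary.PropositionalEquality

-- Reindexing λ turns each predicate τ_a ∘ F(σ_a ∘ T(k₁,…,k_N)) of the meet given by
-- condition (2) into σ_a ∘ T(τ_a ∘ F k₁, …, τ_a ∘ F k_N), by pasting the naturality
-- square of λ with the square (1). Since each τ_a ∘ F kᵢ is an 𝔼-morphism
-- F^Ω_τ Pᵢ → Ω a, that predicate is one of the meetands of T^Ω_σ(F^Ω_τ P₁, …).

module _ {ℓ} {𝔹 : Category ℓ} (Fib : CLatFibration 𝔹) where
  open Category 𝔹
  open CLatFibration Fib

  ⊑-reindex-⋀ : ∀ {X Y} {P : E X} (f : Hom X Y) {I : Set ℓ} {φ : I → E Y} →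
                (∀ i → P ⊑ (f ^*) (φ i)) → P ⊑ (f ^*) (⋀ φ)
  ⊑-reindex-⋀ {P = P} f {φ = φ} P⊑ =
    subst (P ⊑_) (sym (reindex-⋀ f φ)) (⋀-greatest _ P P⊑)

  ⊑-reindex-∘ : ∀ {X Y Z} {P : E X} (g : Hom Y Z) (f : Hom X Y) {Q : E Z} →
                P ⊑ ((g ∘ f) ^*) Q → P ⊑ (f ^*) ((g ^*) Q)
  ⊑-reindex-∘ {P = P} g f {Q} = subst (P ⊑_) (reindex-∘ g f Q)

module _ {ℓ} (𝔹 : Category ℓ) (Fib : CLatFibration 𝔹)
         (A : Set ℓ) (O : A → Category.Obj 𝔹)
         (Ω : (a : A) → CLatFibration.E Fib (O a)) where
  open Category 𝔹
  open CLatFibration Fib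
  open Codensity 𝔹 Fib A O Ω

  FLift-hom : (F : Functor 𝔹) (τ : (a : A) → Hom (Functor.F₀ F (O a)) (O a))
              {X : Obj} {P : E X} {a : A} →
              (k : EHom P (Ω a)) → EHom (FLift F τ P) (Ω a)
  FLift-hom F τ {a = a} k = τ a ∘ Functor.F₁ F (proj₁ k) , ⋀-lower _ (a , k)

  TLift-hom : {N : ℕ} (T : NFunctor 𝔹 N)
              (σ : (a : A) → Hom (NFunctor.T₀ T (λ _ → O a)) (O a))
              {X : Fin N → Obj} {P : (i : Fin N) → E (X i)} {a : A} →
              (k : (i : Fin N) → EHom (P i) (Ω a)) → EHom (TLift T σ P) (Ω a)
  TLift-hom T σ {a = a} k =
    σ a ∘ NFunctor.T₁ T (λ i → proj₁ (k i)) , ⋀-lower _ (a , k)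

module _ {ℓ} {𝔹 : Category ℓ} {F : Functor 𝔹} {N : ℕ} {T : NFunctor 𝔹 N}
         (λ' : OneStep F T) where
  open Category 𝔹
  open Functor F
  open NFunctor T
  open OneStep λ'

  lam-pasting : ∀ {o : Obj} (τ : Hom (F₀ o) o) (σ : Hom (T₀ (λ _ → o)) o) →
                σ ∘ T₁ (λ _ → τ) ≡ τ ∘ (F₁ σ ∘ lam (λ _ → o)) →
                ∀ {X : Fin N → Obj} (k : (i : Fin N) → Hom (X i) o) →
                (τ ∘ F₁ (σ ∘ T₁ k)) ∘ lam X ≡ σ ∘ T₁ (λ i → τ ∘ F₁ (k i))
  lam-pasting {o} τ σ square {X} k = begin
      (τ ∘ F₁ (σ ∘ T₁ k)) ∘ lam X
    ≡⟨ assoc _ _ _ ⟩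
      τ ∘ (F₁ (σ ∘ T₁ k) ∘ lam X)
    ≡⟨ cong (λ g → τ ∘ (g ∘ lam X)) (F-∘ σ (T₁ k)) ⟩
      τ ∘ ((F₁ σ ∘ F₁ (T₁ k)) ∘ lam X)
    ≡⟨ cong (τ ∘_) (assoc _ _ _) ⟩
      τ ∘ (F₁ σ ∘ (F₁ (T₁ k) ∘ lam X))
    ≡⟨ cong (λ g → τ ∘ (F₁ σ ∘ g)) (sym (lam-natural k)) ⟩
      τ ∘ (F₁ σ ∘ (lam (λ _ → o) ∘ T₁ Fk))
    ≡⟨ cong (τ ∘_) (sym (assoc _ _ _)) ⟩
      τ ∘ ((F₁ σ ∘ lam (λ _ → o)) ∘ T₁ Fk)
    ≡⟨ sym (assoc _ _ _) ⟩
      (τ ∘ (F₁ σ ∘ lam (λ _ → o))) ∘ T₁ Fk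
    ≡⟨ cong (_∘ T₁ Fk) (sym square) ⟩
      (σ ∘ T₁ (λ _ → τ)) ∘ T₁ Fk
    ≡⟨ assoc _ _ _ ⟩
      σ ∘ (T₁ (λ _ → τ) ∘ T₁ Fk)
    ≡⟨ cong (σ ∘_) (sym (T-∘ (λ _ → τ) Fk)) ⟩
      σ ∘ T₁ (λ i → τ ∘ F₁ (k i))
    ∎
    where
    open ≡-Reasoning
    Fk : (i : Fin N) → Hom (F₀ (X i)) (F₀ o)
    Fk i = F₁ (k i)

theorem4 : ∀ {ℓ} (𝔹 : Category ℓ) (Fib : CLatFibration 𝔹)
    (A : Set ℓ) (O : A → Category.Obj 𝔹)
    (Ω : (a : A) → CLatFibration.E Fib (O a))
    (F : Functor 𝔹)
    (τ : (a : A) → Category.Hom 𝔹 (Functor.F₀ F (O a)) (O a))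
    (N : ℕ) (T : NFunctor 𝔹 N) (λ' : OneStep F T)
    (σ : (a : A) → Category.Hom 𝔹 (NFunctor.T₀ T (λ _ → O a)) (O a)) →
    Codensity.Condition1 𝔹 Fib A O Ω F τ T λ' σ →
    Codensity.Condition2 𝔹 Fib A O Ω F τ T σ →
    Codensity.Lifts 𝔹 Fib A O Ω F τ T λ' σ
theorem4 𝔹 Fib A O Ω F τ N T λ' σ condition1 condition2 {X} P =
  subst (TLift-of-FLift ⊑_) (cong (lam X ^*) (condition2 P))
    (⊑-reindex-⋀ Fib (lam X) below-meetand)
  where
  open Category 𝔹
  open CLatFibration Fib
  open Functor F
  open NFunctor T
  open OneStep λ'
  open Codensity 𝔹 Fib A O Ω

  TLift-of-FLift : E (T₀ (λ i → F₀ (X i)))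
  TLift-of-FLift = TLift T σ (λ i → FLift F τ (P i))

  below-meetand : ((a , k) : Σ A (λ a → (i : Fin N) → EHom (P i) (Ω a))) →
                  TLift-of-FLift
                    ⊑ (lam X ^*) (((τ a ∘ F₁ (σ a ∘ T₁ (λ i → proj₁ (k i)))) ^*) (Ω a))
  below-meetand (a , k) =
    ⊑-reindex-∘ Fib _ (lam X)
      (subst (TLift-of-FLift ⊑_)
        (cong (λ g → (g ^*) (Ω a))
              (sym (lam-pasting λ' (τ a) (σ a) (condition1 a) (λ i → proj₁ (k i)))))
        (proj₂ (TLift-hom 𝔹 Fib A O Ω T σ (λ i → FLift-hom 𝔹 Fib A O Ω F τ (k i)))))
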